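{- (Arbitrary vs. Arbitrary, lower bound.) For all sufficiently large $n$, there is a nonempty set $\mathcal{A} \subsetneq \{0,1\}^n$ such that every first-order $\tau_{\mathsf{string}}$-sentence that is true in $\mathbf{B}_w$ for all $w \in \mathcal{A}$ and false in $\mathbf{B}_{w'}$ for all $w' \in \{0,1\}^n\setminus\mathcal{A}$ has at least $n/\log(n)$ quantifiers.
   Context: $\tau_{\mathsf{string}} = \langle <, S; \mathsf{min}, \mathsf{max}\rangle$ with $<$ binary, $S$ unary, $\mathsf{min},\mathsf{max}$ constants. A string $w = w_1\cdots w_n \in \{0,1\}^n$ is encoded by the structure $\mathbf{B}_w$ with universe $\{1,\dots,n\}$, $<$ the usual order, $S = \{i : w_i = 1\}$, $\mathsf{min}=1$, $\mathsf{max}=n$. The number of quantifiers of a sentence is the number of quantifier occurrences. $\log$ is base 2. -}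

module Defs where

open import Data.Nat using (ℕ; zero; suc; _<ᵇ_; _≡ᵇ_)
open import Data.Fin using (Fin; toℕ; fromℕ)
open import Data.Bool using (Bool; true; false; not; _∧_; _∨_)
open import Data.Vec using (Vec; lookup)
open import Data.List using (allFin)
open import Data.Bool.ListAction using (any; all)

-- First-order logic over the vocabulary τ_string = ⟨ <, S ; min, max ⟩ (with equality).
-- Formulas are in de Bruijn style: Formula k has k free variables.

data Term (k : ℕ) : Set where
  var  : Fin k → Term k
  cmin : Term k
  cmax : Term k

data Formula (k : ℕ) : Set where
  _≐_  : Term k → Term k → Formula k
  _≺_  : Term k → Term k → Formula k
  S    : Term k → Formula k
  ¬'   : Formula k → Formula k
  _∧'_ : Formula k → Formula k → Formula k
  _∨'_ : Formula k → Formula k → Formula k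
  _⇒'_ : Formula k → Formula k → Formula k
  ∃'   : Formula (suc k) → Formula k
  ∀'   : Formula (suc k) → Formula k

Sentence : Set
Sentence = Formula 0

quantifiers : ∀ {k} → Formula k → ℕ
quantifiers (_ ≐ _)   = 0
quantifiers (_ ≺ _)   = 0
quantifiers (S _)     = 0
quantifiers (¬' φ)    = quantifiers φ
quantifiers (φ ∧' ψ)  = quantifiers φ Data.Nat.+ quantifiers ψ
quantifiers (φ ∨' ψ)  = quantifiers φ Data.Nat.+ quantifiers ψ
quantifiers (φ ⇒' ψ)  = quantifiers φ Data.Nat.+ quantifiers ψ
quantifiers (∃' φ)    = suc (quantifiers φ)
quantifiers (∀' φ)    = suc (quantifiers φ)

-- The structure B_w for a string w ∈ {0,1}^(suc m) (true = 1):
-- universe Fin (suc m) (position i+1 is the element i), usual order,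
-- S = positions carrying 1, min = first, max = last position.

module _ {m : ℕ} (w : Vec Bool (suc m)) where

  Env : ℕ → Set
  Env k = Fin k → Fin (suc m)

  extend : ∀ {k} → Fin (suc m) → Env k → Env (suc k)
  extend a ρ Fin.zero    = a
  extend a ρ (Fin.suc i) = ρ i

  evalT : ∀ {k} → Env k → Term k → Fin (suc m)
  evalT ρ (var i) = ρ i
  evalT ρ cmin    = Fin.zero
  evalT ρ cmax    = fromℕ m

  eval : ∀ {k} → Env k → Formula k → Bool
  eval ρ (s ≐ t)  = toℕ (evalT ρ s) ≡ᵇ toℕ (evalT ρ t)
  eval ρ (s ≺ t)  = toℕ (evalT ρ s) <ᵇ toℕ (evalT ρ t)
  eval ρ (S t)    = lookup w (evalT ρ t)
  eval ρ (¬' φ)   = not (eval ρ φ)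
  eval ρ (φ ∧' ψ) = eval ρ φ ∧ eval ρ ψ
  eval ρ (φ ∨' ψ) = eval ρ φ ∨ eval ρ ψ
  eval ρ (φ ⇒' ψ) = not (eval ρ φ) ∨ eval ρ ψ
  eval ρ (∃' φ)   = any (λ a → eval (extend a ρ) φ) (allFin (suc m))
  eval ρ (∀' φ)   = all (λ a → eval (extend a ρ) φ) (allFin (suc m))

  noEnv : Env 0
  noEnv ()

  holds : Sentence → Bool
  holds φ = eval noEnv φ

{-# OPTIONS --safe #-}
module Submission where

-- A formula with k free variables is a Boolean combination of atoms about the k + 2 terms min,
-- max and its variables, and of existential subformulas; so its truth value is a Boolean function
-- (its skeleton) of the order type of the positions the terms denote, the letters at these
-- positions, and the truth values of its maximal existential subformulas. There are few order
-- types, so counting skeletons and recursing into the subformulas, whose quantifier counts add up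
-- to less than q, shows that sentences with at most Q quantifiers define at most 2 ^ (2 (Q + 1) E)
-- sets of strings of length n, where E = 4 ^ (Q + 1) (Q + 3) ^ (Q + 2) bounds the number of inputs
-- of a skeleton. If n ≥ 2 ^ 64 and Q is the largest q with n ^ q < 2 ^ n, this is less than
-- 2 ^ 2 ^ n − 2, so some set of strings differs from all of them and from the two trivial ones;
-- a sentence defining it has q > Q quantifiers, hence n ^ q ≥ 2 ^ n.

open import Defs
open import Data.Bool using (Bool; true; false; not; _∧_; _∨_; if_then_else_; T)
open import Data.Bool.ListAction using (any; all; or)
open import Data.Bool.Properties using (¬-not) renaming (_≟_ to _≟ᵇ_)
open import Data.Fin using (Fin; zero; suc; toℕ; fromℕ<; combine; quotient; remainder)
open import Data.Fin.Properties using (2↔Bool; combine-remQuot; toℕ-fromℕ<)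
open import Data.List using (List; []; _∷_; _++_; length; map; cartesianProduct; allFin)
open import Data.List.Properties using (length-++; length-map; map-cong)
open import Data.List.Membership.Propositional using (_∈_)
open import Data.List.Membership.Propositional.Properties
  using (∈-map⁺; ∈-++⁺ˡ; ∈-++⁺ʳ; ∈-cartesianProduct⁺)
open import Data.List.Relation.Unary.Any using (here; there)
open import Data.Nat
  using (ℕ; zero; suc; _+_; _*_; _∸_; _^_; _≤_; _<_; z≤n; s≤s; _<?_; _≤?_; _<ᵇ_; _≡ᵇ_; NonZero; >-nonZero)
open import Data.Nat.Induction using (<-rec)
open import Data.Nat.Properties
open import Data.Nat.Solver using (module +-*-Solver)
open import Data.Product using (Σ; ∃; _×_; _,_; proj₁; proj₂)
open import Data.Sum using (inj₁; inj₂)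
open import Data.Unit using (tt)
open import Data.Vec as Vec using (Vec; []; _∷_; lookup; tabulate; take; drop; head; tail; count)
open import Data.Vec.Properties
  using (count≤n; lookup-map; lookup∘tabulate; map-++; sum-++; take++drop≡id; ++-injectiveˡ; ++-injectiveʳ)
import Data.Vec.Membership.Propositional as Vec
open import Data.Vec.Relation.Unary.Any using (here; there)
open import Data.Vec.Membership.Propositional.Properties using (∈-lookup)
open import Function using (id; _∘_; case_of_)
open import Function.Bundles using (Inverse)
open import Relation.Binary using (tri<; tri≈; tri>)
open import Relation.Binary.PropositionalEquality
open import Relation.Nullary using (yes; no; does; contradiction)
open import Relation.Nullary.Reflects using (ofʸ; ofⁿ; det; fromEquivalence)
open import Relation.Unary using (U; Decidable)
open +-*-Solver using (solve; _:+_; _:*_; _:=_; con)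

Pointwise : {X Y Y′ : Set} → (Y → Y′ → Set) → (X → Y) → (X → Y′) → Set
Pointwise _∼_ f g = ∀ x → f x ∼ g x

record Cover {A B : Set} (P : A → Set) (_∼_ : A → B → Set) (s : ℕ) : Set where
  constructor mkCover
  field
    points  : List B
    size    : length points ≤ s
    covered : ∀ {a} → P a → ∃ λ b → b ∈ points × a ∼ b
open Cover

module _ {A B : Set} {_∼_ : A → B → Set} where

  cover-≤ : ∀ {P s t} → s ≤ t → Cover P _∼_ s → Cover P _∼_ t
  cover-≤ s≤t (mkCover bs size cov) = mkCover bs (≤-trans size s≤t) cov

  cover-refine : ∀ {P : A → Set} {A′ B′ : Set} {P′ : A′ → Set} {_≈_ : A′ → B′ → Set} {s} (f : B → B′) →
                 (∀ {a′} → P′ a′ → ∃ λ a → P a × (∀ {b} → a ∼ b → a′ ≈ f b)) →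
                 Cover P _∼_ s → Cover P′ _≈_ s
  cover-refine f reduce (mkCover bs size cov) =
    mkCover (map f bs) (≤-trans (≤-reflexive (length-map f bs)) size) λ p′ →
      let a , p , a∼⇒ = reduce p′
          b , b∈ , a∼b = cov p
      in f b , ∈-map⁺ f b∈ , a∼⇒ a∼b

  cover-⋃ : ∀ {Pᵢ : ℕ → A → Set} {s} n → (∀ {i} → i < n → Cover (Pᵢ i) _∼_ s) →
            Cover (λ a → ∃ λ i → i < n × Pᵢ i a) _∼_ (n * s)
  cover-⋃ zero    _  = mkCover [] z≤n λ { (_ , () , _) }
  cover-⋃ (suc n) cᵢ with cᵢ (n<1+n n) | cover-⋃ n (cᵢ ∘ m<n⇒m<1+n)
  ... | mkCover bs size cov | mkCover bs′ size′ cov′ =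
    mkCover (bs ++ bs′) (≤-trans (≤-reflexive (length-++ bs)) (+-mono-≤ size size′)) λ where
      (i , i<1+n , p) → case m<1+n⇒m<n∨m≡n i<1+n of λ where
        (inj₂ refl) → let b , b∈ , a∼b = cov p in b , ∈-++⁺ˡ b∈ , a∼b
        (inj₁ i<n)  → let b , b∈ , a∼b = cov′ (i , i<n , p) in b , ∈-++⁺ʳ bs b∈ , a∼b

length-cartesianProduct : {A B : Set} (xs : List A) (ys : List B) →
                          length (cartesianProduct xs ys) ≡ length xs * length ys
length-cartesianProduct []       ys = refl
length-cartesianProduct (x ∷ xs) ys = begin
  length (map (x ,_) ys ++ cartesianProduct xs ys)         ≡⟨ length-++ (map (x ,_) ys) ⟩
  length (map (x ,_) ys) + length (cartesianProduct xs ys)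
    ≡⟨ cong₂ _+_ (length-map (x ,_) ys) (length-cartesianProduct xs ys) ⟩
  length ys + length xs * length ys                        ∎
  where open ≡-Reasoning

cover-× : ∀ {A₁ B₁ A₂ B₂ : Set} {P₁ : A₁ → Set} {P₂ : A₂ → Set}
            {_∼₁_ : A₁ → B₁ → Set} {_∼₂_ : A₂ → B₂ → Set} {s₁ s₂} →
          Cover P₁ _∼₁_ s₁ → Cover P₂ _∼₂_ s₂ →
          Cover (λ a → P₁ (proj₁ a) × P₂ (proj₂ a)) (λ a b → proj₁ a ∼₁ proj₁ b × proj₂ a ∼₂ proj₂ b) (s₁ * s₂)
cover-× (mkCover bs₁ size₁ cov₁) (mkCover bs₂ size₂ cov₂) =
  mkCover (cartesianProduct bs₁ bs₂)
    (≤-trans (≤-reflexive (length-cartesianProduct bs₁ bs₂)) (*-mono-≤ size₁ size₂))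
    λ (p₁ , p₂) → let b₁ , b₁∈ , a₁∼b₁ = cov₁ p₁
                      b₂ , b₂∈ , a₂∼b₂ = cov₂ p₂
                  in (b₁ , b₂) , ∈-cartesianProduct⁺ b₁∈ b₂∈ , a₁∼b₁ , a₂∼b₂

cover-Bool : Cover U _≡_ 2
cover-Bool = mkCover (true ∷ false ∷ []) ≤-refl λ
  { {true}  _ → true , here refl , refl
  ; {false} _ → false , there (here refl) , refl
  }

Tabulable : Set → ℕ → Set₁
Tabulable X d = ∀ {Y Y′ : Set} {_∼_ : Y → Y′ → Set} {s} →
                Cover U _∼_ s → Cover U (Pointwise {X} _∼_) (s ^ d)

tabulable-Fin : ∀ r → Tabulable (Fin r) r
tabulable-Fin zero    c = mkCover ((λ ()) ∷ []) ≤-refl λ _ → (λ ()) , here refl , λ ()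
tabulable-Fin (suc r) c =
  cover-refine cons (λ {f} _ → (f zero , f ∘ suc) , _ , λ { (f₀∼ , f₊∼) → λ { zero → f₀∼ ; (suc i) → f₊∼ i } })
    (cover-× c (tabulable-Fin r c))
  where
  cons : ∀ {Y : Set} → Y × (Fin r → Y) → Fin (suc r) → Y
  cons (y , g) zero    = y
  cons (y , g) (suc i) = g i

tabulable-Bool : Tabulable Bool 2
tabulable-Bool {s = s} c =
  cover-≤ (≤-reflexive (cong (s *_) (sym (*-identityʳ s))))
    (cover-refine (λ (y , z) b → if b then y else z)
      (λ {f} _ → (f true , f false) , _ , λ { (t∼ , f∼) → λ { true → t∼ ; false → f∼ } })
      (cover-× c c))

tabulable-Vec : ∀ {X a} → Tabulable X a → ∀ d → Tabulable (Vec X d) (a ^ d)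
tabulable-Vec tab zero {s = s} c =
  cover-≤ (≤-reflexive (sym (*-identityʳ s)))
    (cover-refine (λ y _ → y) (λ {f} _ → f [] , _ , λ { f[]∼ [] → f[]∼ }) c)
tabulable-Vec {X} {a} tab (suc d) {s = s} c =
  cover-≤ (≤-reflexive size-eq)
    (cover-refine uncurryᵛ (λ {f} _ → (λ x v → f (x ∷ v)) , _ , λ { f∼ (x ∷ v) → f∼ x v })
      (tab (tabulable-Vec tab d c)))
  where
  uncurryᵛ : ∀ {Y : Set} → (X → Vec X d → Y) → Vec X (suc d) → Y
  uncurryᵛ g (x ∷ v) = g x v
  size-eq : (s ^ a ^ d) ^ a ≡ s ^ a ^ suc d
  size-eq = trans (^-*-assoc s (a ^ d) a) (cong (s ^_) (*-comm (a ^ d) a))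

restrict : ∀ {N} → Bool → List (Fin (suc N) → Bool) → List (Fin N → Bool)
restrict b []       = []
restrict b (f ∷ fs) = if does (f zero ≟ᵇ b) then (f ∘ suc) ∷ restrict b fs else restrict b fs

restrict-length : ∀ {N} (fs : List (Fin (suc N) → Bool)) →
                  length (restrict true fs) + length (restrict false fs) ≡ length fs
restrict-length []       = refl
restrict-length (f ∷ fs) with f zero
... | true  = cong suc (restrict-length fs)
... | false = trans (+-suc _ _) (cong suc (restrict-length fs))

restrict-∈ : ∀ {N} {f : Fin (suc N) → Bool} {fs} → f ∈ fs → (f ∘ suc) ∈ restrict (f zero) fs
restrict-∈ {f = f} (here refl) with f zero
... | true  = here refl
... | false = here refl
restrict-∈ {f = f} {g ∷ fs} (there f∈) with does (g zero ≟ᵇ f zero)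
... | true  = there (restrict-∈ f∈)
... | false = restrict-∈ f∈

short-restriction : ∀ {N} (fs : List (Fin (suc N) → Bool)) → length fs < 2 ^ suc N →
                    ∃ λ b → length (restrict b fs) < 2 ^ N
short-restriction {N} fs len with length (restrict true fs) <? 2 ^ N
... | yes short = true , short
... | no  long  = false , +-cancelˡ-< (2 ^ N) _ _ (begin-strict
  2 ^ N + length (restrict false fs)                     ≤⟨ +-monoˡ-≤ _ (≮⇒≥ long) ⟩
  length (restrict true fs) + length (restrict false fs) ≡⟨ restrict-length fs ⟩
  length fs                                              <⟨ len ⟩
  2 ^ suc N                                              ≡⟨ cong (2 ^ N +_) (+-identityʳ (2 ^ N)) ⟩
  2 ^ N + 2 ^ N                                          ∎)
  where open ≤-Reasoning

avoid : ∀ N (fs : List (Fin N → Bool)) → length fs < 2 ^ N →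
        ∃ λ (g : Fin N → Bool) → ∀ {f} → f ∈ fs → ∃ λ i → g i ≢ f i
avoid zero    []      _        = (λ ()) , λ ()
avoid zero    (_ ∷ _) (s≤s ())
avoid (suc N) fs      len with short-restriction fs len
... | b , len′ with avoid N (restrict b fs) len′
...   | g , g-avoids = g′ , g′-avoids
  where
  g′ : Fin (suc N) → Bool
  g′ zero    = b
  g′ (suc i) = g i
  g′-avoids : ∀ {f} → f ∈ fs → ∃ λ i → g′ i ≢ f i
  g′-avoids {f} f∈ with f zero ≟ᵇ b
  ... | no  f₀≢b = zero , f₀≢b ∘ sym
  ... | yes refl = let i , gᵢ≢fᵢ = g-avoids (restrict-∈ f∈) in suc i , gᵢ≢fᵢ

open Inverse 2↔Bool using () renaming (to to bit; from to digit; strictlyInverseʳ to digit-bit)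

index : ∀ {n} → Vec Bool n → Fin (2 ^ n)
index []      = zero
index (b ∷ w) = combine (digit b) (index w)

string : ∀ n → Fin (2 ^ n) → Vec Bool n
string zero    _ = []
string (suc n) i = bit (quotient {2} (2 ^ n) i) ∷ string n (remainder {2} (2 ^ n) i)

index-string : ∀ n (i : Fin (2 ^ n)) → index (string n i) ≡ i
index-string zero    zero = refl
index-string (suc n) i    =
  trans (cong₂ combine (digit-bit (quotient {2} (2 ^ n) i)) (index-string n (remainder {2} (2 ^ n) i)))
        (combine-remQuot {2} (2 ^ n) i)

avoid-strings : ∀ n (fs : List (Vec Bool n → Bool)) → length fs < 2 ^ 2 ^ n →
                ∃ λ (g : Vec Bool n → Bool) → ∀ {f} → f ∈ fs → ∃ λ w → g w ≢ f w
avoid-strings n fs len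
  with avoid (2 ^ n) (map (_∘ string n) fs) (subst (_< 2 ^ 2 ^ n) (sym (length-map _ fs)) len)
... | g , g-avoids = g ∘ index , λ f∈ →
  let i , gᵢ≢fᵢ = g-avoids (∈-map⁺ (_∘ string n) f∈)
  in string n i , gᵢ≢fᵢ ∘ trans (cong g (sym (index-string n i)))

rank : ∀ {r} → Vec ℕ r → ℕ → ℕ
rank v x = count (_<? x) v

-- count (_<? x) computes with the Boolean u <ᵇ x, so the proofs below split on it and on its reflection.
rank-mono : ∀ {r} (v : Vec ℕ r) {x y} → x ≤ y → rank v x ≤ rank v y
rank-mono []      x≤y = z≤n
rank-mono (u ∷ v) {x} {y} x≤y with u <ᵇ x | <ᵇ-reflects-< u x | u <ᵇ y | <ᵇ-reflects-< u y
... | true  | _       | true  | _       = s≤s (rank-mono v x≤y)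
... | true  | ofʸ u<x | false | ofⁿ u≮y = contradiction (<-≤-trans u<x x≤y) u≮y
... | false | _       | true  | _       = m≤n⇒m≤1+n (rank-mono v x≤y)
... | false | _       | false | _       = rank-mono v x≤y

rank-strict : ∀ {r} {v : Vec ℕ r} {x y} → x Vec.∈ v → x < y → rank v x < rank v y
rank-strict {v = x ∷ v} {x} {y} (here refl) x<y
  with x <ᵇ x | <ᵇ-reflects-< x x | x <ᵇ y | <ᵇ-reflects-< x y
... | true  | ofʸ x<x | _     | _       = contradiction x<x (<-irrefl refl)
... | false | _       | true  | _       = s≤s (rank-mono v (<⇒≤ x<y))
... | false | _       | false | ofⁿ x≮y = contradiction x<y x≮y
rank-strict {v = u ∷ v} {x} {y} (there x∈v) x<y
  with u <ᵇ x | <ᵇ-reflects-< u x | u <ᵇ y | <ᵇ-reflects-< u y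
... | true  | _       | true  | _       = s≤s (rank-strict x∈v x<y)
... | true  | ofʸ u<x | false | ofⁿ u≮y = contradiction (<-trans u<x x<y) u≮y
... | false | _       | true  | _       = m<n⇒m<1+n (rank-strict x∈v x<y)
... | false | _       | false | _       = rank-strict x∈v x<y

rank-<ᵇ : ∀ {r} {v : Vec ℕ r} {x} y → x Vec.∈ v → (rank v x <ᵇ rank v y) ≡ (x <ᵇ y)
rank-<ᵇ {v = v} {x} y x∈v =
  det (fromEquivalence reflect (<⇒<ᵇ ∘ rank-strict x∈v)) (<ᵇ-reflects-< x y)
  where
  reflect : T (rank v x <ᵇ rank v y) → x < y
  reflect rx<ry = ≰⇒> λ y≤x → <⇒≱ (<ᵇ⇒< _ _ rx<ry) (rank-mono v y≤x)

rank-≡ᵇ : ∀ {r} {v : Vec ℕ r} {x y} → x Vec.∈ v → y Vec.∈ v → (rank v x ≡ᵇ rank v y) ≡ (x ≡ᵇ y)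
rank-≡ᵇ {v = v} {x} {y} x∈v y∈v =
  det (fromEquivalence (reflect ∘ ≡ᵇ⇒≡ _ _) (≡⇒≡ᵇ _ _ ∘ cong (rank v)))
      (fromEquivalence (≡ᵇ⇒≡ x y) (≡⇒≡ᵇ x y))
  where
  reflect : rank v x ≡ rank v y → x ≡ y
  reflect rx≡ry with <-cmp x y
  ... | tri< x<y _ _ = contradiction rx≡ry (<⇒≢ (rank-strict x∈v x<y))
  ... | tri≈ _ x≡y _ = x≡y
  ... | tri> _ _ y<x = contradiction (sym rx≡ry) (<⇒≢ (rank-strict y∈v y<x))

ranks : ∀ {r} → Vec ℕ r → Vec (Fin (suc r)) r
ranks v = Vec.map (λ x → fromℕ< (s≤s (count≤n (_<? x) v))) v

lookup-ranks : ∀ {r} (v : Vec ℕ r) i → toℕ (lookup (ranks v) i) ≡ rank v (lookup v i)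
lookup-ranks v i = trans (cong toℕ (lookup-map i _ v)) (toℕ-fromℕ< _)

ranks-<ᵇ : ∀ {r} (v : Vec ℕ r) i j →
           (toℕ (lookup (ranks v) i) <ᵇ toℕ (lookup (ranks v) j)) ≡ (lookup v i <ᵇ lookup v j)
ranks-<ᵇ v i j = trans (cong₂ _<ᵇ_ (lookup-ranks v i) (lookup-ranks v j)) (rank-<ᵇ _ (∈-lookup i v))

ranks-≡ᵇ : ∀ {r} (v : Vec ℕ r) i j →
           (toℕ (lookup (ranks v) i) ≡ᵇ toℕ (lookup (ranks v) j)) ≡ (lookup v i ≡ᵇ lookup v j)
ranks-≡ᵇ v i j =
  trans (cong₂ _≡ᵇ_ (lookup-ranks v i) (lookup-ranks v j)) (rank-≡ᵇ (∈-lookup i v) (∈-lookup j v))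

take-++ : ∀ {A : Set} {m n} (xs : Vec A m) (ys : Vec A n) → take m (xs Vec.++ ys) ≡ xs
take-++ {m = m} xs ys = ++-injectiveˡ _ xs (take++drop≡id m (xs Vec.++ ys))

drop-++ : ∀ {A : Set} {m n} (xs : Vec A m) (ys : Vec A n) → drop m (xs Vec.++ ys) ≡ ys
drop-++ {m = m} xs ys = ++-injectiveʳ _ xs (take++drop≡id m (xs Vec.++ ys))

not-any-not : ∀ {A : Set} (p : A → Bool) xs → not (any (not ∘ p) xs) ≡ all p xs
not-any-not p []       = refl
not-any-not p (x ∷ xs) with p x
... | true  = not-any-not p xs
... | false = refl

-- The inputs of a skeleton are the ranks of the positions of min, max and the free variables (in
-- this order), the letters at these positions and the truth values of the existential blocks;
-- ∀ φ is decomposed as ¬ ∃ ¬ φ.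
Skeleton : ℕ → ℕ → Set
Skeleton k j = Vec (Fin (3 + k)) (2 + k) → Vec Bool (2 + k) → Vec Bool j → Bool

record Decomposition (k : ℕ) : Set where
  constructor decomposition
  field
    arity    : ℕ
    skeleton : Skeleton k arity
    blocks   : Vec (Formula (suc k)) arity
open Decomposition

termIndex : ∀ {k} → Term k → Fin (2 + k)
termIndex cmin    = zero
termIndex cmax    = suc zero
termIndex (var i) = suc (suc i)

termAt : ∀ {k} → Fin (2 + k) → Term k
termAt zero          = cmin
termAt (suc zero)    = cmax
termAt (suc (suc i)) = var i

termAt-termIndex : ∀ {k} (t : Term k) → termAt (termIndex t) ≡ t
termAt-termIndex cmin    = refl
termAt-termIndex cmax    = refl
termAt-termIndex (var i) = refl

module _ {m : ℕ} (w : Vec Bool (suc m)) {k : ℕ} (ρ : Env w k) where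

  positions : Vec ℕ (2 + k)
  positions = tabulate (toℕ ∘ evalT w ρ ∘ termAt)

  letters : Vec Bool (2 + k)
  letters = tabulate (lookup w ∘ evalT w ρ ∘ termAt)

  blockValues : ∀ {j} → Vec (Formula (suc k)) j → Vec Bool j
  blockValues = Vec.map (eval w ρ ∘ ∃')

  lookup-positions : ∀ t → lookup positions (termIndex t) ≡ toℕ (evalT w ρ t)
  lookup-positions t =
    trans (lookup∘tabulate (toℕ ∘ evalT w ρ ∘ termAt) (termIndex t))
          (cong (toℕ ∘ evalT w ρ) (termAt-termIndex t))

  lookup-letters : ∀ t → lookup letters (termIndex t) ≡ lookup w (evalT w ρ t)
  lookup-letters t =
    trans (lookup∘tabulate (lookup w ∘ evalT w ρ ∘ termAt) (termIndex t))
          (cong (lookup w ∘ evalT w ρ) (termAt-termIndex t))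

⟦_⟧ : ∀ {m k} → Decomposition k → (w : Vec Bool (suc m)) → Env w k → Bool
⟦ decomposition _ G ψs ⟧ w ρ = G (ranks (positions w ρ)) (letters w ρ) (blockValues w ρ ψs)

weight : ∀ {k j} → Vec (Formula (suc k)) j → ℕ
weight = Vec.sum ∘ Vec.map (suc ∘ quantifiers)

arity≤weight : ∀ {k j} (ψs : Vec (Formula (suc k)) j) → j ≤ weight ψs
arity≤weight []       = z≤n
arity≤weight (ψ ∷ ψs) = s≤s (≤-trans (arity≤weight ψs) (m≤n+m _ _))

weight-++ : ∀ {k j₁ j₂} (ψs₁ : Vec (Formula (suc k)) j₁) (ψs₂ : Vec (Formula (suc k)) j₂) →
            weight (ψs₁ Vec.++ ψs₂) ≡ weight ψs₁ + weight ψs₂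
weight-++ ψs₁ ψs₂ =
  trans (cong Vec.sum (map-++ (suc ∘ quantifiers) ψs₁ ψs₂)) (sum-++ (Vec.map (suc ∘ quantifiers) ψs₁))

atomic : ∀ {k} → (Vec (Fin (3 + k)) (2 + k) → Vec Bool (2 + k) → Bool) → Decomposition k
atomic G = decomposition 0 (λ c b _ → G c b) []

negation : ∀ {k} → Decomposition k → Decomposition k
negation d = decomposition (arity d) (λ c b v → not (skeleton d c b v)) (blocks d)

connective : ∀ {k} → (Bool → Bool → Bool) → Decomposition k → Decomposition k → Decomposition k
connective _⊕_ d₁ d₂ =
  decomposition (arity d₁ + arity d₂)
    (λ c b v → skeleton d₁ c b (take (arity d₁) v) ⊕ skeleton d₂ c b (drop (arity d₁) v))
    (blocks d₁ Vec.++ blocks d₂)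

decompose : ∀ {k} → Formula k → Decomposition k
decompose (s ≐ t)  = atomic λ c _ → toℕ (lookup c (termIndex s)) ≡ᵇ toℕ (lookup c (termIndex t))
decompose (s ≺ t)  = atomic λ c _ → toℕ (lookup c (termIndex s)) <ᵇ toℕ (lookup c (termIndex t))
decompose (S t)    = atomic λ _ b → lookup b (termIndex t)
decompose (¬' φ)   = negation (decompose φ)
decompose (φ ∧' ψ) = connective _∧_ (decompose φ) (decompose ψ)
decompose (φ ∨' ψ) = connective _∨_ (decompose φ) (decompose ψ)
decompose (φ ⇒' ψ) = connective (λ a b → not a ∨ b) (decompose φ) (decompose ψ)
decompose (∃' φ)   = decomposition 1 (λ _ _ v → head v) (φ ∷ [])
decompose (∀' φ)   = decomposition 1 (λ _ _ v → not (head v)) (¬' φ ∷ [])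

connective-sound : ∀ {m k} _⊕_ (d₁ d₂ : Decomposition k) (w : Vec Bool (suc m)) ρ →
                   ⟦ connective _⊕_ d₁ d₂ ⟧ w ρ ≡ ⟦ d₁ ⟧ w ρ ⊕ ⟦ d₂ ⟧ w ρ
connective-sound _⊕_ (decomposition _ _ ψs₁) (decomposition _ _ ψs₂) w ρ
  rewrite map-++ (eval w ρ ∘ ∃') ψs₁ ψs₂
        | take-++ (blockValues w ρ ψs₁) (blockValues w ρ ψs₂)
        | drop-++ (blockValues w ρ ψs₁) (blockValues w ρ ψs₂) = refl

decompose-sound : ∀ {m k} (φ : Formula k) (w : Vec Bool (suc m)) ρ → ⟦ decompose φ ⟧ w ρ ≡ eval w ρ φ
decompose-sound (s ≐ t) w ρ =
  trans (ranks-≡ᵇ (positions w ρ) (termIndex s) (termIndex t))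
        (cong₂ _≡ᵇ_ (lookup-positions w ρ s) (lookup-positions w ρ t))
decompose-sound (s ≺ t) w ρ =
  trans (ranks-<ᵇ (positions w ρ) (termIndex s) (termIndex t))
        (cong₂ _<ᵇ_ (lookup-positions w ρ s) (lookup-positions w ρ t))
decompose-sound (S t)    w ρ = lookup-letters w ρ t
decompose-sound (¬' φ)   w ρ = cong not (decompose-sound φ w ρ)
decompose-sound (φ ∧' ψ) w ρ =
  trans (connective-sound _∧_ (decompose φ) (decompose ψ) w ρ)
        (cong₂ _∧_ (decompose-sound φ w ρ) (decompose-sound ψ w ρ))
decompose-sound (φ ∨' ψ) w ρ =
  trans (connective-sound _∨_ (decompose φ) (decompose ψ) w ρ)
        (cong₂ _∨_ (decompose-sound φ w ρ) (decompose-sound ψ w ρ))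
decompose-sound (φ ⇒' ψ) w ρ =
  trans (connective-sound (λ a b → not a ∨ b) (decompose φ) (decompose ψ) w ρ)
        (cong₂ (λ a b → not a ∨ b) (decompose-sound φ w ρ) (decompose-sound ψ w ρ))
decompose-sound (∃' φ)   w ρ = refl
decompose-sound {m} (∀' φ) w ρ = not-any-not (λ a → eval w (extend w a ρ) φ) (allFin (suc m))

decompose-weight : ∀ {k} (φ : Formula k) → weight (blocks (decompose φ)) ≡ quantifiers φ
connective-weight : ∀ {k} (φ ψ : Formula k) →
                    weight (blocks (decompose φ) Vec.++ blocks (decompose ψ)) ≡ quantifiers φ + quantifiers ψ
connective-weight φ ψ =
  trans (weight-++ (blocks (decompose φ)) (blocks (decompose ψ)))
        (cong₂ _+_ (decompose-weight φ) (decompose-weight ψ))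
decompose-weight (s ≐ t)  = refl
decompose-weight (s ≺ t)  = refl
decompose-weight (S t)    = refl
decompose-weight (¬' φ)   = decompose-weight φ
decompose-weight (φ ∧' ψ) = connective-weight φ ψ
decompose-weight (φ ∨' ψ) = connective-weight φ ψ
decompose-weight (φ ⇒' ψ) = connective-weight φ ψ
decompose-weight (∃' φ)   = cong suc (+-identityʳ _)
decompose-weight (∀' φ)   = cong suc (+-identityʳ _)

^-distribʳ-* : ∀ a b n → (a * b) ^ n ≡ a ^ n * b ^ n
^-distribʳ-* a b zero    = refl
^-distribʳ-* a b (suc n) = begin
  a * b * (a * b) ^ n     ≡⟨ cong (a * b *_) (^-distribʳ-* a b n) ⟩
  a * b * (a ^ n * b ^ n) ≡⟨ solve 4 (λ a b x y → a :* b :* (x :* y) := a :* x :* (b :* y)) refl a b (a ^ n) (b ^ n) ⟩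
  a * a ^ n * (b * b ^ n) ∎
  where open ≡-Reasoning

1+n≤2^n : ∀ n → suc n ≤ 2 ^ n
1+n≤2^n zero    = ≤-refl
1+n≤2^n (suc n) = +-mono-≤ (m^n>0 2 n) (≤-trans (1+n≤2^n n) (≤-reflexive (sym (+-identityʳ (2 ^ n)))))

8+n≤2^[3+n] : ∀ n → 8 + n ≤ 2 ^ (3 + n)
8+n≤2^[3+n] zero    = ≤-refl
8+n≤2^[3+n] (suc n) =
  ≤-trans (≤-reflexive (+-suc 8 n))
    (+-mono-≤ (m^n>0 2 (3 + n)) (≤-trans (8+n≤2^[3+n] n) (≤-reflexive (sym (+-identityʳ (2 ^ (3 + n)))))))

4³*[8+n]³≤8^[5+n] : ∀ n → 4 ^ 3 * (8 + n) ^ 3 ≤ 8 ^ (5 + n)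
4³*[8+n]³≤8^[5+n] n = begin
  4 ^ 3 * (8 + n) ^ 3       ≤⟨ *-monoʳ-≤ (4 ^ 3) (^-monoˡ-≤ 3 (8+n≤2^[3+n] n)) ⟩
  4 ^ 3 * (2 ^ (3 + n)) ^ 3 ≡⟨ cong (4 ^ 3 *_) (trans (^-*-assoc 2 (3 + n) 3) (cong (2 ^_) (*-comm (3 + n) 3))) ⟩
  4 ^ 3 * 2 ^ (3 * (3 + n)) ≡⟨ cong (4 ^ 3 *_) (^-*-assoc 2 3 (3 + n)) ⟨
  8 ^ 2 * 8 ^ (3 + n)       ≡⟨ ^-distribˡ-+-* 8 2 (3 + n) ⟨
  8 ^ (5 + n)               ∎
  where open ≤-Reasoning

exponent-bound : ∀ c .{{_ : NonZero c}} {n Q} → 2 ^ c ≤ n → n ^ Q < 2 ^ n → c * Q < n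
exponent-bound c {n} {Q} 2^c≤n n^Q<2^n = ≰⇒> λ n≤cQ → <-irrefl refl (begin-strict
  n ^ n       ≤⟨ ^-monoʳ-≤ n n≤cQ ⟩
  n ^ (c * Q) ≡⟨ cong (n ^_) (*-comm c Q) ⟩
  n ^ (Q * c) ≡⟨ ^-*-assoc n Q c ⟨
  (n ^ Q) ^ c <⟨ ^-monoˡ-< c n^Q<2^n ⟩
  (2 ^ n) ^ c ≡⟨ trans (^-*-assoc 2 n c) (trans (cong (2 ^_) (*-comm n c)) (sym (^-*-assoc 2 c n))) ⟩
  (2 ^ c) ^ n ≤⟨ ^-monoˡ-≤ n 2^c≤n ⟩
  n ^ n       ∎)
  where
  open ≤-Reasoning
  instance
    n-nonZero : NonZero n
    n-nonZero = >-nonZero (≤-trans (m^n>0 2 c) 2^c≤n)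

-- For Q ≥ 5, exponent-bound gives 32 (Q + 3) ≤ n, and (4 (Q + 3)) ^ 3 ≤ 8 ^ Q absorbs the excess
-- of the exponent Q + 3 over Q; smaller Q are settled by 4 ^ 7 * 8 ^ 7 = 2 ^ 35.
4^[3+Q]*[3+Q]^[3+Q]<2^n : ∀ {n Q} → 2 ^ 64 ≤ n → n ^ Q < 2 ^ n → 4 ^ (3 + Q) * (3 + Q) ^ (3 + Q) < 2 ^ n
4^[3+Q]*[3+Q]^[3+Q]<2^n {n} {Q} 2^64≤n n^Q<2^n with Q ≤? 4
... | yes Q≤4 = begin-strict
  4 ^ (3 + Q) * (3 + Q) ^ (3 + Q) ≤⟨ *-mono-≤ (^-monoʳ-≤ 4 T≤7)
                                              (≤-trans (^-monoˡ-≤ (3 + Q) (m≤n⇒m≤1+n T≤7)) (^-monoʳ-≤ 8 T≤7)) ⟩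
  4 ^ 7 * 8 ^ 7                   ≡⟨⟩
  2 ^ 35                          <⟨ ^-monoʳ-< 2 (s≤s (s≤s z≤n)) (≤-trans (≤ᵇ⇒≤ 36 (2 ^ 64) tt) 2^64≤n) ⟩
  2 ^ n                           ∎
  where
  open ≤-Reasoning
  T≤7 : 3 + Q ≤ 7
  T≤7 = +-monoʳ-≤ 3 Q≤4
... | no Q≰4 with m≤n⇒∃[o]m+o≡n (≰⇒> Q≰4)
...   | a , refl = begin-strict
  4 ^ (8 + a) * (8 + a) ^ (8 + a)                         ≡⟨ cong₂ _*_ (^-distribˡ-+-* 4 3 (5 + a)) (^-distribˡ-+-* (8 + a) 3 (5 + a)) ⟩
  4 ^ 3 * 4 ^ (5 + a) * ((8 + a) ^ 3 * (8 + a) ^ (5 + a)) ≡⟨ solve 4 (λ x y z u → x :* y :* (z :* u) := x :* z :* (y :* u)) refl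
                                                               (4 ^ 3) (4 ^ (5 + a)) ((8 + a) ^ 3) ((8 + a) ^ (5 + a)) ⟩
  4 ^ 3 * (8 + a) ^ 3 * (4 ^ (5 + a) * (8 + a) ^ (5 + a)) ≤⟨ *-monoˡ-≤ _ (4³*[8+n]³≤8^[5+n] a) ⟩
  8 ^ (5 + a) * (4 ^ (5 + a) * (8 + a) ^ (5 + a))         ≡⟨ cong (8 ^ (5 + a) *_) (^-distribʳ-* 4 (8 + a) (5 + a)) ⟨
  8 ^ (5 + a) * (4 * (8 + a)) ^ (5 + a)                   ≡⟨ ^-distribʳ-* 8 (4 * (8 + a)) (5 + a) ⟨
  (8 * (4 * (8 + a))) ^ (5 + a)                           ≤⟨ ^-monoˡ-≤ (5 + a) 32T≤n ⟩
  n ^ (5 + a)                                             <⟨ n^Q<2^n ⟩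
  2 ^ n                                                   ∎
  where
  open ≤-Reasoning
  32T≤64Q : 32 * (8 + a) ≤ 64 * (5 + a)
  32T≤64Q = ≤-trans (m≤m+n (32 * (8 + a)) (64 + 32 * a))
    (≤-reflexive (solve 1 (λ a → con 32 :* (con 8 :+ a) :+ (con 64 :+ con 32 :* a) := con 64 :* (con 5 :+ a)) refl a))
  32T≤n : 8 * (4 * (8 + a)) ≤ n
  32T≤n = ≤-trans (≤-reflexive (sym (*-assoc 8 4 (8 + a))))
            (≤-trans 32T≤64Q (<⇒≤ (exponent-bound 64 2^64≤n n^Q<2^n)))

maximal : ∀ {P : ℕ → Set} → Decidable P → P 0 → ∀ b → (∀ {q} → P q → q ≤ b) →
          ∃ λ Q → P Q × (∀ {q} → P q → q ≤ Q)
maximal P? P0 zero    bounded = 0 , P0 , bounded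
maximal P? P0 (suc b) bounded with P? (suc b)
... | yes Pb  = suc b , Pb , bounded
... | no  ¬Pb = maximal P? P0 b λ Pq → m<1+n⇒m≤n (≤∧≢⇒< (bounded Pq) λ { refl → ¬Pb Pq })

largest-exponent : ∀ {n} → 2 ^ 64 ≤ n → ∃ λ Q → n ^ Q < 2 ^ n × (∀ {q} → n ^ q < 2 ^ n → q ≤ Q)
largest-exponent {n} 2^64≤n =
  maximal (λ q → n ^ q <? 2 ^ n) (^-monoʳ-< 2 ≤-refl (≤-trans (m^n>0 2 64) 2^64≤n)) n
    (λ {q} small → ≤-trans (m≤n*m q 64) (<⇒≤ (exponent-bound 64 {n} {q} 2^64≤n small)))

skeletons : ∀ k j → Cover {Skeleton k j} U (Pointwise (Pointwise (Pointwise _≡_)))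
                          (((2 ^ 2 ^ j) ^ 2 ^ (2 + k)) ^ (3 + k) ^ (2 + k))
skeletons k j =
  tabulable-Vec (tabulable-Fin (3 + k)) (2 + k)
    (tabulable-Vec tabulable-Bool (2 + k) (tabulable-Vec tabulable-Bool j cover-Bool))

-- M bounds the number of skeletons for k, j ≤ Q; formulas with at most q quantifiers are
-- covered by Y * X ^ q semantic representatives and vectors of blocks of weight at most q by X ^ q.
module Bounds (Q : ℕ) where

  E : ℕ
  E = 2 ^ Q * 2 ^ (2 + Q) * (3 + Q) ^ (2 + Q)

  M : ℕ
  M = 2 ^ E

  Y : ℕ
  Y = suc Q * M

  X : ℕ
  X = suc Q * Y

  instance
    M-nonZero : NonZero M
    M-nonZero = m^n≢0 2 E
    Y-nonZero : NonZero Y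
    Y-nonZero = m*n≢0 (suc Q) M
    X-nonZero : NonZero X
    X-nonZero = m*n≢0 (suc Q) Y

  skeletons-size : ∀ {k j} → k ≤ Q → j ≤ Q → ((2 ^ 2 ^ j) ^ 2 ^ (2 + k)) ^ (3 + k) ^ (2 + k) ≤ M
  skeletons-size {k} {j} k≤Q j≤Q = begin
    ((2 ^ 2 ^ j) ^ 2 ^ (2 + k)) ^ (3 + k) ^ (2 + k) ≡⟨ cong (_^ (3 + k) ^ (2 + k)) (^-*-assoc 2 (2 ^ j) (2 ^ (2 + k))) ⟩
    (2 ^ (2 ^ j * 2 ^ (2 + k))) ^ (3 + k) ^ (2 + k) ≡⟨ ^-*-assoc 2 (2 ^ j * 2 ^ (2 + k)) ((3 + k) ^ (2 + k)) ⟩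
    2 ^ (2 ^ j * 2 ^ (2 + k) * (3 + k) ^ (2 + k))
      ≤⟨ ^-monoʳ-≤ 2 (*-mono-≤ (*-mono-≤ (^-monoʳ-≤ 2 j≤Q) (^-monoʳ-≤ 2 (+-monoʳ-≤ 2 k≤Q))) types≤) ⟩
    M                                               ∎
    where
    open ≤-Reasoning
    types≤ : (3 + k) ^ (2 + k) ≤ (3 + Q) ^ (2 + Q)
    types≤ = ≤-trans (^-monoˡ-≤ (2 + k) (+-monoʳ-≤ 3 k≤Q)) (^-monoʳ-≤ (3 + Q) (+-monoʳ-≤ 2 k≤Q))

  piece-size : ∀ {q₁ p} → q₁ ≤ p → Y * X ^ q₁ * X ^ (p ∸ q₁) ≡ Y * X ^ p
  piece-size {q₁} {p} q₁≤p = begin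
    Y * X ^ q₁ * X ^ (p ∸ q₁)   ≡⟨ *-assoc Y (X ^ q₁) (X ^ (p ∸ q₁)) ⟩
    Y * (X ^ q₁ * X ^ (p ∸ q₁)) ≡⟨ cong (Y *_) (^-distribˡ-+-* X q₁ (p ∸ q₁)) ⟨
    Y * X ^ (q₁ + (p ∸ q₁))     ≡⟨ cong ((Y *_) ∘ (X ^_)) (m+[n∸m]≡n q₁≤p) ⟩
    Y * X ^ p                   ∎
    where open ≡-Reasoning

  blocks-size : ∀ {p} → p ≤ Q → suc p * (Y * X ^ p) ≤ X ^ suc p
  blocks-size {p} p≤Q = begin
    suc p * (Y * X ^ p) ≤⟨ *-monoˡ-≤ (Y * X ^ p) (s≤s p≤Q) ⟩
    suc Q * (Y * X ^ p) ≡⟨ *-assoc (suc Q) Y (X ^ p) ⟨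
    X ^ suc p           ∎
    where open ≤-Reasoning

  formulas-size : ∀ {q} → q ≤ Q → suc q * (M * X ^ q) ≤ Y * X ^ q
  formulas-size {q} q≤Q = begin
    suc q * (M * X ^ q) ≤⟨ *-monoˡ-≤ (M * X ^ q) (s≤s q≤Q) ⟩
    suc Q * (M * X ^ q) ≡⟨ *-assoc (suc Q) M (X ^ q) ⟨
    Y * X ^ q           ∎
    where open ≤-Reasoning

  1≤E : 1 ≤ E
  1≤E = *-mono-≤ (*-mono-≤ (m^n>0 2 Q) (m^n>0 2 (2 + Q))) (m^n>0 (3 + Q) (2 + Q))

  X≤2^[E+E] : X ≤ 2 ^ (E + E)
  X≤2^[E+E] = begin
    suc Q * (suc Q * M) ≡⟨ *-assoc (suc Q) (suc Q) M ⟨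
    suc Q * suc Q * M   ≤⟨ *-monoˡ-≤ M [1+Q]²≤M ⟩
    M * M               ≡⟨ ^-distribˡ-+-* 2 E E ⟨
    2 ^ (E + E)         ∎
    where
    open ≤-Reasoning
    [1+Q]²≤M : suc Q * suc Q ≤ M
    [1+Q]²≤M = begin
      suc Q * suc Q       ≤⟨ *-mono-≤ (1+n≤2^n Q) (≤-trans (1+n≤2^n Q) (^-monoʳ-≤ 2 (m≤n+m Q 2))) ⟩
      2 ^ Q * 2 ^ (2 + Q) ≤⟨ m≤m*n _ ((3 + Q) ^ (2 + Q)) {{m^n≢0 (3 + Q) (2 + Q)}} ⟩
      E                   ≤⟨ <⇒≤ (1+n≤2^n E) ⟩
      M                   ∎

  K : ℕ
  K = (E + E) * suc Q

  1+K≤4^[3+Q]*[3+Q]^[3+Q] : suc K ≤ 4 ^ (3 + Q) * (3 + Q) ^ (3 + Q)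
  1+K≤4^[3+Q]*[3+Q]^[3+Q] = begin
    suc K                                       ≡⟨ +-comm 1 K ⟩
    K + 1                                       ≤⟨ +-monoʳ-≤ K (*-mono-≤ {1} {E} {1} 1≤E (s≤s z≤n)) ⟩
    K + E * (46 + 14 * Q)                       ≡⟨ solve 2 (λ e q → (e :+ e) :* (con 1 :+ q) :+ e :* (con 46 :+ con 14 :* q)
                                                                   := con 16 :* (con 3 :+ q) :* e) refl E Q ⟩
    16 * (3 + Q) * E                            ≡⟨ solve 3 (λ a p q → con 64 :* (a :* a) :* ((con 3 :+ q) :* p)
                                                                   := con 16 :* (con 3 :+ q) :* (a :* (con 2 :* (con 2 :* a)) :* p))
                                                         refl (2 ^ Q) ((3 + Q) ^ (2 + Q)) Q ⟨
    4 ^ 3 * (2 ^ Q * 2 ^ Q) * (3 + Q) ^ (3 + Q)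
      ≡⟨ cong (_* (3 + Q) ^ (3 + Q)) (trans (^-distribˡ-+-* 4 3 Q) (cong (4 ^ 3 *_) (^-distribʳ-* 2 2 Q))) ⟨
    4 ^ (3 + Q) * (3 + Q) ^ (3 + Q)             ∎
    where open ≤-Reasoning

  cover-bound : ∀ {n} → 4 ^ (3 + Q) * (3 + Q) ^ (3 + Q) < 2 ^ n → 2 + Y * X ^ Q < 2 ^ 2 ^ n
  cover-bound {n} small = begin-strict
    2 + Y * X ^ Q             ≤⟨ +-monoʳ-≤ 2 (*-monoˡ-≤ (X ^ Q) (m≤n*m Y (suc Q))) ⟩
    2 + X ^ suc Q             ≤⟨ +-monoʳ-≤ 2 (^-monoˡ-≤ (suc Q) X≤2^[E+E]) ⟩
    2 + (2 ^ (E + E)) ^ suc Q ≡⟨ cong (2 +_) (^-*-assoc 2 (E + E) (suc Q)) ⟩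
    2 + 2 ^ K                 ≤⟨ +-monoˡ-≤ (2 ^ K) (^-monoʳ-≤ 2 1≤K) ⟩
    2 ^ K + 2 ^ K             ≡⟨ cong (2 ^ K +_) (+-identityʳ (2 ^ K)) ⟨
    2 ^ suc K                 <⟨ ^-monoʳ-< 2 ≤-refl (≤-<-trans 1+K≤4^[3+Q]*[3+Q]^[3+Q] small) ⟩
    2 ^ 2 ^ n                 ∎
    where
    open ≤-Reasoning
    1≤K : 1 ≤ K
    1≤K = *-mono-≤ {1} {E + E} {1} {suc Q} (≤-trans 1≤E (m≤m+n E E)) (s≤s z≤n)

module _ (m : ℕ) where

  Sem : ℕ → Set
  Sem k = (w : Vec Bool (suc m)) → Env w k → Bool

  exists : ∀ {k} → Sem (suc k) → Sem k
  exists s w ρ = any (λ a → s w (extend w a ρ)) (allFin (suc m))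

  _≋_ : ∀ {k} → Formula k → Sem k → Set
  φ ≋ s = ∀ w ρ → eval w ρ φ ≡ s w ρ

  _≋ᵇ_ : ∀ {k j} → Vec (Formula (suc k)) j → ((w : Vec Bool (suc m)) → Env w k → Vec Bool j) → Set
  ψs ≋ᵇ v = ∀ w ρ → blockValues w ρ ψs ≡ v w ρ

  _≋ᵈ_ : ∀ {k} → Decomposition k → Sem k → Set
  d ≋ᵈ s = ∀ w ρ → ⟦ d ⟧ w ρ ≡ s w ρ

  exists-cong : ∀ {k} {ψ : Formula (suc k)} {s} → ψ ≋ s → ∃' ψ ≋ exists s
  exists-cong ψ≋s w ρ = cong or (map-cong (λ a → ψ≋s w (extend w a ρ)) (allFin (suc m)))

  module _ (Q : ℕ) where
    open Bounds Q

    FormulaCover : ℕ → ℕ → Set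
    FormulaCover k q = Cover (λ (φ : Formula k) → quantifiers φ ≤ q) _≋_ (Y * X ^ q)

    BlockCover : ℕ → ℕ → ℕ → Set
    BlockCover k q j = Cover (λ (ψs : Vec (Formula (suc k)) j) → weight ψs ≤ q) _≋ᵇ_ (X ^ q)

    blockCover : ∀ {k} q j → q ≤ Q → (∀ {q′} → q′ < q → FormulaCover (suc k) q′) → BlockCover k q j
    blockCover q       zero    _     _      =
      mkCover ((λ _ _ → []) ∷ []) (m^n>0 X q) λ { {[]} _ → _ , here refl , λ _ _ → refl }
    blockCover zero    (suc j) _     _      = mkCover [] z≤n λ { {_ ∷ _} () }
    blockCover {k} (suc p) (suc j) 1+p≤Q covers =
      cover-refine id split (cover-≤ (blocks-size (<⇒≤ 1+p≤Q)) (cover-⋃ (suc p) piece))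
      where
      Piece : ℕ → Vec (Formula (suc k)) (suc j) → Set
      Piece q₁ ψs = quantifiers (head ψs) ≤ q₁ × weight (tail ψs) ≤ p ∸ q₁
      piece : ∀ {q₁} → q₁ < suc p → Cover (Piece q₁) _≋ᵇ_ (Y * X ^ p)
      piece {q₁} q₁<1+p =
        cover-≤ (≤-reflexive (piece-size q₁≤p))
          (cover-refine (λ (s , v) w ρ → exists s w ρ ∷ v w ρ)
             (λ { {ψ ∷ ψs} (h₁ , h₂) →
                  (ψ , ψs) , (h₁ , h₂) , λ (ψ≋s , ψs≋v) w ρ → cong₂ _∷_ (exists-cong {ψ = ψ} ψ≋s w ρ) (ψs≋v w ρ) })
             (cover-× (covers (s≤s q₁≤p))
                (blockCover (p ∸ q₁) j (≤-trans (m∸n≤m p q₁) (<⇒≤ 1+p≤Q))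
                   λ q′<p∸q₁ → covers (m<n⇒m<1+n (<-≤-trans q′<p∸q₁ (m∸n≤m p q₁))))))
        where
        q₁≤p : q₁ ≤ p
        q₁≤p = ≤-pred q₁<1+p
      split : ∀ {ψs} → weight ψs ≤ suc p →
              ∃ λ ψs′ → (∃ λ q₁ → q₁ < suc p × Piece q₁ ψs′) × (∀ {v} → ψs′ ≋ᵇ v → ψs ≋ᵇ v)
      split {ψ ∷ ψs} (s≤s q+w≤p) =
        ψ ∷ ψs ,
        (quantifiers ψ , s≤s (m+n≤o⇒m≤o _ q+w≤p) , ≤-refl ,
         m+n≤o⇒m≤o∸n (weight ψs) (subst (_≤ p) (+-comm (quantifiers ψ) (weight ψs)) q+w≤p)) ,
        id

    formulaCover : ∀ q {k} → k + q ≤ Q → FormulaCover k q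
    formulaCover = <-rec (λ q → ∀ {k} → k + q ≤ Q → FormulaCover k q) step
      where
      step : ∀ q → (∀ {q′} → q′ < q → ∀ {k} → k + q′ ≤ Q → FormulaCover k q′) →
             ∀ {k} → k + q ≤ Q → FormulaCover k q
      step q covers {k} k+q≤Q =
        cover-refine id (λ {φ} → split {φ}) (cover-≤ (formulas-size q≤Q) (cover-⋃ (suc q) piece))
        where
        q≤Q : q ≤ Q
        q≤Q = m+n≤o⇒n≤o k k+q≤Q
        Piece : ℕ → Decomposition k → Set
        Piece j d = arity d ≡ j × weight (blocks d) ≤ q
        piece : ∀ {j} → j < suc q → Cover (Piece j) _≋ᵈ_ (M * X ^ q)
        piece {j} j<1+q =
          cover-≤ (*-monoˡ-≤ (X ^ q) (skeletons-size (m+n≤o⇒m≤o k k+q≤Q) (≤-trans (≤-pred j<1+q) q≤Q)))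
            (cover-refine (λ (G , v) w ρ → G (ranks (positions w ρ)) (letters w ρ) (v w ρ))
              (λ { {decomposition _ G ψs} (refl , wt) →
                   (G , ψs) , (_ , wt) , λ (G≗ , ψs≋v) w ρ → trans (cong (G _ _) (ψs≋v w ρ)) (G≗ _ _ _) })
              (cover-× (skeletons k j)
                 (blockCover q j q≤Q λ q′<q →
                    covers q′<q (subst (_≤ Q) (+-suc k _) (≤-trans (+-monoʳ-≤ k q′<q) k+q≤Q)))))
        split : ∀ {φ : Formula k} → quantifiers φ ≤ q →
                ∃ λ d → (∃ λ j → j < suc q × Piece j d) × (∀ {s} → d ≋ᵈ s → φ ≋ s)
        split {φ} q≤ =
          decompose φ ,
          (arity (decompose φ) , s≤s (≤-trans (arity≤weight (blocks (decompose φ))) wt) , refl , wt) ,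
          λ d≋s w ρ → trans (sym (decompose-sound φ w ρ)) (d≋s w ρ)
          where
          wt : weight (blocks (decompose φ)) ≤ q
          wt = subst (_≤ q) (sym (decompose-weight φ)) q≤

agree : ∀ {a b : Bool} → (a ≡ true → b ≡ true) → (a ≡ false → b ≡ false) → a ≡ b
agree {true}  t _ = sym (t refl)
agree {false} _ f = sym (f refl)

language : ∀ {m} → Sem m 0 → Vec Bool (suc m) → Bool
language s w = s w (noEnv w)

undefinable-language : ∀ {m Q s} → Cover (λ (φ : Sentence) → quantifiers φ ≤ Q) (_≋_ m) s → 2 + s < 2 ^ 2 ^ suc m →
    Σ (Vec Bool (suc m) → Bool) λ A →
      (∃ λ w → A w ≡ true) × (∃ λ w → A w ≡ false) ×
      (∀ (φ : Sentence) →
        (∀ w → A w ≡ true → holds w φ ≡ true) →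
        (∀ w → A w ≡ false → holds w φ ≡ false) →
        Q < quantifiers φ)
undefinable-language {m} {Q} C fits
  with avoid-strings (suc m) ((λ _ → true) ∷ (λ _ → false) ∷ map language (points C))
         (≤-<-trans (s≤s (s≤s (≤-trans (≤-reflexive (length-map language (points C))) (size C)))) fits)
... | A , avoids =
  A , (_ , ¬-not (proj₂ (avoids (there (here refl))))) , (_ , ¬-not (proj₂ (avoids (here refl)))) , beyond
  where
  beyond : ∀ (φ : Sentence) →
      (∀ w → A w ≡ true → holds w φ ≡ true) →
      (∀ w → A w ≡ false → holds w φ ≡ false) →
      Q < quantifiers φ
  beyond φ φ-true φ-false = ≰⇒> λ q≤Q →
    let s , s∈ , φ≋s = covered C {φ} q≤Q
        w , A≢s      = avoids (there (there (∈-map⁺ language s∈)))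
    in A≢s (trans (agree (φ-true w) (φ-false w)) (φ≋s w (noEnv w)))

hard-language : ∀ {m Q} → 2 ^ 64 ≤ suc m → suc m ^ Q < 2 ^ suc m → (∀ {q} → suc m ^ q < 2 ^ suc m → q ≤ Q) →
    Σ (Vec Bool (suc m) → Bool) λ A →
      (∃ λ w → A w ≡ true) × (∃ λ w → A w ≡ false) ×
      (∀ (φ : Sentence) →
        (∀ w → A w ≡ true → holds w φ ≡ true) →
        (∀ w → A w ≡ false → holds w φ ≡ false) →
        2 ^ suc m ≤ suc m ^ quantifiers φ)
hard-language {m} {Q} 2^64≤n n^Q<2^n Q-max =
  -- let rather than with: abstracting over this term makes Agda normalise formulaCover.
  let A , nonempty , proper , beyond =
        undefinable-language (formulaCover m Q Q ≤-refl)
          (Bounds.cover-bound Q {suc m} (4^[3+Q]*[3+Q]^[3+Q]<2^n {suc m} {Q} 2^64≤n n^Q<2^n))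
  in A , nonempty , proper , λ φ φ-true φ-false → ≮⇒≥ λ small → <⇒≱ (beyond φ φ-true φ-false) (Q-max small)

theorem5p6 : ∃ λ (N : ℕ) → ∀ (m : ℕ) → N ≤ suc m →
    Σ (Vec Bool (suc m) → Bool) λ A →
      (∃ λ w → A w ≡ true) × (∃ λ w → A w ≡ false) ×
      (∀ (φ : Sentence) →
        (∀ w → A w ≡ true → holds w φ ≡ true) →
        (∀ w → A w ≡ false → holds w φ ≡ false) →
        2 ^ suc m ≤ suc m ^ quantifiers φ)
theorem5p6 = 2 ^ 64 , λ m 2^64≤n →
  let Q , n^Q<2^n , Q-max = largest-exponent 2^64≤n
  in hard-language 2^64≤n n^Q<2^n Q-max
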